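{- Let $G$ be a nice graph. Then, for every set $W$ of $2\cdot|E(G)|$ distinct strictly positive integers, there exists an edge-injective neighbour-sum-distinguishing $W$-edge-weighting of $G$. In particular, $\chi^{e,1}_\Sigma(G)\leq 2\cdot|E(G)|$.
   Context: All graphs are finite, simple, undirected and loopless. A graph is nice if none of its connected components is isomorphic to $K_2$. For a set $W$ of weights, a $W$-edge-weighting of $G$ is a map $w:E(G)\to W$; a $k$-edge-weighting is a $\{1,\dots,k\}$-edge-weighting. For a vertex $v$, $\sigma_w(v)=\sum_{u\in N(v)} w(vu)$. The weighting $w$ is neighbour-sum-distinguishing if $\sigma_w(u)\neq\sigma_w(v)$ for every edge $uv$, and edge-injective if no two distinct edges receive the same weight. For a nice graph $G$, $\chi^{e,1}_\Sigma(G)$ is the smallest $k$ such that $G$ admits an edge-injective neighbour-sum-distinguishing $k$-edge-weighting. -}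

module Defs where

open import Data.Nat using (ℕ; zero; suc; _+_; _*_; _<_; _≤_)
open import Data.Fin using (Fin; toℕ)
open import Data.Product using (_×_; _,_; proj₁; proj₂; ∃)
open import Relation.Binary.PropositionalEquality using (_≡_)
open import Relation.Nullary using (¬_; Dec; yes; no)
open import Data.Fin using (_≟_)
open import Function.Definitions using (Injective)
open import Data.Sum using (_⊎_)

-- Edge i is the pair (src i , tgt i) with src i < tgt i (no loops, a
-- canonical orientation), and distinct edge indices give distinct pairs
-- (no multi-edges).  E(G) is thus identified with Fin m, |E(G)| = m.
record Graph (n m : ℕ) : Set where
  field
    src tgt  : Fin m → Fin n
    ordered  : ∀ i → toℕ (src i) < toℕ (tgt i)
    simple   : ∀ i j → src i ≡ src j → tgt i ≡ tgt j → i ≡ j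
open Graph public

sumFin : ∀ {m} → (Fin m → ℕ) → ℕ
sumFin {zero}  f = 0
sumFin {suc m} f = f Fin.zero + sumFin (λ i → f (Fin.suc i))

Incident : ∀ {n m} → Graph n m → Fin m → Fin n → Set
Incident G i v = (src G i ≡ v) ⊎ (tgt G i ≡ v)

contrib : ∀ {n m} → Graph n m → (Fin m → ℕ) → Fin n → Fin m → ℕ
contrib G w v i with src G i ≟ v | tgt G i ≟ v
... | yes _ | _     = w i
... | no _  | yes _ = w i
... | no _  | no _  = 0

σ : ∀ {n m} → Graph n m → (Fin m → ℕ) → Fin n → ℕ
σ G w v = sumFin (contrib G w v)

-- edge i forms a connected component isomorphic to K₂:
-- no other edge shares an endpoint with it
IsolatedEdge : ∀ {n m} → Graph n m → Fin m → Set
IsolatedEdge G i = ∀ j → (Incident G j (src G i) ⊎ Incident G j (tgt G i)) → j ≡ i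

Nice : ∀ {n m} → Graph n m → Set
Nice G = ∀ i → ¬ IsolatedEdge G i

EdgeInjective : ∀ {m} → (Fin m → ℕ) → Set
EdgeInjective w = Injective _≡_ _≡_ w

NeighbourSumDistinguishing : ∀ {n m} → Graph n m → (Fin m → ℕ) → Set
NeighbourSumDistinguishing G w = ∀ i → ¬ (σ G w (src G i) ≡ σ G w (tgt G i))

-- w is a W-edge-weighting, W given as the image of a map Fin k → ℕ
ValuesIn : ∀ {m k} → (Fin m → ℕ) → (Fin k → ℕ) → Set
ValuesIn w W = ∀ i → ∃ λ j → w i ≡ W j

IsKWeighting : ∀ {m} → ℕ → (Fin m → ℕ) → Set
IsKWeighting k w = ∀ i → 1 ≤ w i × w i ≤ k

-- Order the edges and weight them greedily from W.  Since G is nice, the two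
-- ends u, v of every edge are separated by some other edge, one touching
-- exactly one of them.  Once the last such edge is weighted, every later edge
-- contributes equally to σ(u) and σ(v), so exactly one value of the current
-- weight would make σ(u) = σ(v).  Each step thus avoids at most m such values
-- and fewer than m weights already used, and 2m weights suffice.
module Submission where

open import Defs
open import Data.Bool using (Bool; true; false; if_then_else_)
import Data.Bool.Properties as Bool
open import Data.Empty using (⊥-elim)
open import Data.Fin using (Fin; zero; suc; toℕ; punchIn; _≟_)
import Data.Fin.Properties as Fin
open import Data.Nat using (ℕ; _+_; _∸_; _*_; _<_; _≤_; s≤s; z≤n)
import Data.Nat.Properties as ℕ
open import Data.Product using (_×_; ∃; _,_; proj₁; proj₂)
import Data.Product as Product
open import Data.Sum using (_⊎_; inj₁; inj₂)
import Data.Sum as Sum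
open import Data.Vec.Functional using (_∷_)
open import Function using (_∘_; id; const)
open import Function.Definitions using (Injective)
open import Relation.Binary.PropositionalEquality
open import Relation.Nullary using (¬_; Dec; yes; no; ¬?)
open import Relation.Nullary.Decidable using (decidable-stable)

sumFin-cong : ∀ {m} {f g : Fin m → ℕ} → (∀ i → f i ≡ g i) → sumFin f ≡ sumFin g
sumFin-cong {ℕ.zero}  f≗g = refl
sumFin-cong {ℕ.suc m} f≗g = cong₂ _+_ (f≗g zero) (sumFin-cong (f≗g ∘ suc))

fresh-value : ∀ {k p} (W : Fin k → ℕ) → Injective _≡_ _≡_ W → p < k →
              (g : Fin p → ℕ) → ∃ λ j → ∀ q → W j ≢ g q
fresh-value W W-inj p<k g =
  Product.map₂ (λ missed q eq → missed (q , eq))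
    (Fin.¬∀⟶∃¬ _ _ (λ j → Fin.any? λ q → W j ℕ.≟ g q) not-all-hit)
  where
  not-all-hit : ¬ (∀ j → ∃ λ q → W j ≡ g q)
  not-all-hit hit with Fin.pigeonhole p<k (proj₁ ∘ hit)
  ... | i , j , i<j , same =
    Fin.<⇒≢ i<j (W-inj (trans (proj₂ (hit i)) (trans (cong g same) (sym (proj₂ (hit j))))))

Incidence : ℕ → ℕ → Set
Incidence m n = Fin m → Fin n → Bool

weightedDegree : ∀ {m n} → Incidence m n → (Fin m → ℕ) → Fin n → ℕ
weightedDegree I w v = sumFin λ i → if I i v then w i else 0

Separates : ∀ {m n} → Incidence m n → Fin n → Fin n → Set
Separates I x y = ∃ λ i → I i x ≢ I i y

separates? : ∀ {m n} (I : Incidence m n) x y → Dec (Separates I x y)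
separates? I x y = Fin.any? λ i → ¬? (I i x Bool.≟ I i y)

separated-by-head : ∀ {m n} (I : Incidence (ℕ.suc m) n) {x y} →
                    Separates I x y → ¬ Separates (I ∘ suc) x y → I zero x ≢ I zero y
separated-by-head I (zero  , ne) _    = ne
separated-by-head I (suc i , ne) ¬sep = ⊥-elim (¬sep (i , ne))

weightedDegree-unseparated : ∀ {m n} (I : Incidence m n) w {x y} →
                             ¬ Separates I x y → weightedDegree I w x ≡ weightedDegree I w y
weightedDegree-unseparated I w {x} {y} ¬sep = sumFin-cong λ i →
  cong (λ b → if b then w i else 0) (decidable-stable (I i x Bool.≟ I i y) (λ ne → ¬sep (i , ne)))

-- The unique weight of a single edge containing exactly one of x, y that
-- makes cx + [x ∈ e] a and cy + [y ∈ e] a equal.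
forbidden : Bool → ℕ → ℕ → ℕ
forbidden true  cx cy = cy ∸ cx
forbidden false cx cy = cx ∸ cy

equalising-weight : ∀ bx by cx cy a → cx ≢ cy ⊎ bx ≢ by →
                    cx + (if bx then a else 0) ≡ cy + (if by then a else 0) →
                    a ≡ forbidden bx cx cy
equalising-weight true  true  cx cy a (inj₁ cx≢cy) eq = ⊥-elim (cx≢cy (ℕ.+-cancelʳ-≡ a cx cy eq))
equalising-weight true  true  _  _  _ (inj₂ b≢b)   _  = ⊥-elim (b≢b refl)
equalising-weight false false cx cy a (inj₁ cx≢cy) eq = ⊥-elim (cx≢cy (ℕ.+-cancelʳ-≡ 0 cx cy eq))
equalising-weight false false _  _  _ (inj₂ b≢b)   _  = ⊥-elim (b≢b refl)
equalising-weight true  false cx cy a _ eq =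
  trans (sym (ℕ.m+n∸m≡n cx a)) (cong (_∸ cx) (trans eq (ℕ.+-identityʳ cy)))
equalising-weight false true  cx cy a _ eq =
  trans (sym (ℕ.m+n∸m≡n cy a)) (cong (_∸ cy) (trans (sym eq) (ℕ.+-identityʳ cx)))

-- Offsets c v accumulate the weights of the edges already fixed.
Distinguishes : ∀ {m n} → (Fin n → ℕ) → Incidence m n → (Fin m → ℕ) → Fin n → Fin n → Set
Distinguishes c I w x y =
  c x ≢ c y ⊎ Separates I x y → c x + weightedDegree I w x ≢ c y + weightedDegree I w y

absorbHead : ∀ {m n} → Incidence (ℕ.suc m) n → ℕ → (Fin n → ℕ) → Fin n → ℕ
absorbHead I a c v = c v + (if I zero v then a else 0)

+-weightedDegree-∷ : ∀ {m n} (I : Incidence (ℕ.suc m) n) a w c v →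
                     c v + weightedDegree I (a ∷ w) v ≡ absorbHead I a c v + weightedDegree (I ∘ suc) w v
+-weightedDegree-∷ I a w c v = sym (ℕ.+-assoc (c v) _ _)

-- If no later edge separates x and y, only the head weight a can equalise them.
∷-distinguishes : ∀ {m n} (I : Incidence (ℕ.suc m) n) c a (w : Fin m → ℕ) {x y} →
                  a ≢ forbidden (I zero x) (c x) (c y) →
                  Distinguishes (absorbHead I a c) (I ∘ suc) w x y →
                  Distinguishes c I (a ∷ w) x y
∷-distinguishes I c a w {x} {y} a-allowed w-dist apart eq
  with eq′ ← trans (sym (+-weightedDegree-∷ I a w c x)) (trans eq (+-weightedDegree-∷ I a w c y))
     | separates? (I ∘ suc) x y
... | yes sep  = w-dist (inj₂ sep) eq′
... | no ¬sep = a-allowed (equalising-weight _ _ _ _ a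
  (Sum.map₂ (λ sep → separated-by-head I sep ¬sep) apart)
  (ℕ.+-cancelʳ-≡ _ _ _ (trans eq′ (cong (absorbHead I a c y +_)
                                          (sym (weightedDegree-unseparated (I ∘ suc) w ¬sep))))))

∷-valuesIn : ∀ {m k} {W : Fin (ℕ.suc k) → ℕ} {w : Fin m → ℕ} j →
             ValuesIn w (W ∘ punchIn j) → ValuesIn (W j ∷ w) W
∷-valuesIn j w-values zero    = j , refl
∷-valuesIn j w-values (suc i) = Product.map (punchIn j) id (w-values i)

valuesIn-punchIn-≢ : ∀ {m k} {W : Fin (ℕ.suc k) → ℕ} {w : Fin m → ℕ} j → Injective _≡_ _≡_ W →
                     ValuesIn w (W ∘ punchIn j) → ∀ i → w i ≢ W j
valuesIn-punchIn-≢ j W-inj w-values i eq with w-values i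
... | j′ , w≡W = Fin.punchInᵢ≢i j j′ (W-inj (trans (sym w≡W) eq))

∷-injective : ∀ {m k} {W : Fin (ℕ.suc k) → ℕ} {w : Fin m → ℕ} j → Injective _≡_ _≡_ W →
              ValuesIn w (W ∘ punchIn j) → EdgeInjective w → EdgeInjective (W j ∷ w)
∷-injective j W-inj w-values w-inj {zero}  {zero}   _  = refl
∷-injective j W-inj w-values w-inj {zero}  {suc i}  eq = ⊥-elim (valuesIn-punchIn-≢ j W-inj w-values i (sym eq))
∷-injective j W-inj w-values w-inj {suc i} {zero}   eq = ⊥-elim (valuesIn-punchIn-≢ j W-inj w-values i eq)
∷-injective j W-inj w-values w-inj {suc i} {suc i′} eq = cong suc (w-inj eq)

greedy-weighting : ∀ {n} m (I : Incidence m n) (c : Fin n → ℕ) {k} (W : Fin k → ℕ) →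
                   Injective _≡_ _≡_ W → ∀ {p} (x y : Fin p → Fin n) → m + p ≤ k →
                   ∃ λ (w : Fin m → ℕ) →
                     ValuesIn w W × EdgeInjective w × (∀ q → Distinguishes c I w (x q) (y q))
greedy-weighting ℕ.zero I c W W-inj x y _ = (λ ()) , (λ ()) , (λ { {()} }) , λ q → no-edges
  where
  no-edges : ∀ {u v} → c u ≢ c v ⊎ Separates I u v → c u + 0 ≢ c v + 0
  no-edges (inj₁ cu≢cv) = cu≢cv ∘ ℕ.+-cancelʳ-≡ 0 _ _
  no-edges (inj₂ (() , _))
greedy-weighting (ℕ.suc m) I c W W-inj x y (s≤s m+p≤k)
  with j , W-allowed ← fresh-value W W-inj (s≤s (ℕ.m+n≤o⇒n≤o m m+p≤k))
                         (λ q → forbidden (I zero (x q)) (c (x q)) (c (y q)))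
  with w , w-values , w-inj , w-dist ← greedy-weighting m (I ∘ suc) (absorbHead I (W j) c)
                         (W ∘ punchIn j) (Fin.punchIn-injective j _ _ ∘ W-inj) x y m+p≤k
  = W j ∷ w , ∷-valuesIn j w-values , ∷-injective j W-inj w-values w-inj ,
    λ q → ∷-distinguishes I c (W j) w (W-allowed q) (w-dist q)

incidence : ∀ {n m} → Graph n m → Incidence m n
incidence G i v with src G i ≟ v | tgt G i ≟ v
... | yes _ | _     = true
... | no _  | yes _ = true
... | no _  | no _  = false

contrib-incidence : ∀ {n m} (G : Graph n m) w v i →
                    contrib G w v i ≡ (if incidence G i v then w i else 0)
contrib-incidence G w v i with src G i ≟ v | tgt G i ≟ v
... | yes _ | _     = refl
... | no _  | yes _ = refl
... | no _  | no _  = refl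

σ-weightedDegree : ∀ {n m} (G : Graph n m) w v → σ G w v ≡ weightedDegree (incidence G) w v
σ-weightedDegree G w v = sumFin-cong (contrib-incidence G w v)

Incident⇒incidence : ∀ {n m} (G : Graph n m) i v → Incident G i v → incidence G i v ≡ true
Incident⇒incidence G i v inc with src G i ≟ v | tgt G i ≟ v
... | yes _ | _     = refl
... | no _  | yes _ = refl
Incident⇒incidence G i v (inj₁ src≡v) | no src≢v | no _ = ⊥-elim (src≢v src≡v)
Incident⇒incidence G i v (inj₂ tgt≡v) | no _ | no tgt≢v = ⊥-elim (tgt≢v tgt≡v)

incidence⇒Incident : ∀ {n m} (G : Graph n m) i v → incidence G i v ≡ true → Incident G i v
incidence⇒Incident G i v _  with src G i ≟ v | tgt G i ≟ v
incidence⇒Incident G i v _  | yes src≡v | _         = inj₁ src≡v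
incidence⇒Incident G i v _  | no _      | yes tgt≡v = inj₂ tgt≡v
incidence⇒Incident G i v () | no _      | no _

Incident-both⇒≡ : ∀ {n m} (G : Graph n m) j q →
                  Incident G j (src G q) → Incident G j (tgt G q) → j ≡ q
Incident-both⇒≡ G j q (inj₁ s≡s) (inj₁ s≡t) =
  ⊥-elim (ℕ.<-irrefl (cong toℕ (trans (sym s≡s) s≡t)) (ordered G q))
Incident-both⇒≡ G j q (inj₁ s≡s) (inj₂ t≡t) = simple G j q s≡s t≡t
Incident-both⇒≡ G j q (inj₂ t≡s) (inj₁ s≡t) =
  ⊥-elim (ℕ.<-asym (ordered G q) (subst₂ _<_ (cong toℕ s≡t) (cong toℕ t≡s) (ordered G j)))
Incident-both⇒≡ G j q (inj₂ t≡s) (inj₂ t≡t) =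
  ⊥-elim (ℕ.<-irrefl (cong toℕ (trans (sym t≡s) t≡t)) (ordered G q))

adjacent⇒separates : ∀ {n m} (G : Graph n m) {j q} → j ≢ q →
                     Incident G j (src G q) ⊎ Incident G j (tgt G q) →
                     incidence G j (src G q) ≢ incidence G j (tgt G q)
adjacent⇒separates G {j} {q} j≢q (inj₁ at-src) same = j≢q (Incident-both⇒≡ G j q at-src
  (incidence⇒Incident G j _ (trans (sym same) (Incident⇒incidence G j _ at-src))))
adjacent⇒separates G {j} {q} j≢q (inj₂ at-tgt) same = j≢q (Incident-both⇒≡ G j q
  (incidence⇒Incident G j _ (trans same (Incident⇒incidence G j _ at-tgt))) at-tgt)

nice⇒ends-separated : ∀ {n m} (G : Graph n m) → Nice G →
                      ∀ q → Separates (incidence G) (src G q) (tgt G q)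
nice⇒ends-separated G nice q with separates? (incidence G) (src G q) (tgt G q)
... | yes sep  = sep
... | no ¬sep = ⊥-elim (nice q isolated)
  where
  isolated : IsolatedEdge G q
  isolated j meets with j ≟ q
  ... | yes j≡q = j≡q
  ... | no j≢q  = ⊥-elim (¬sep (j , adjacent⇒separates G j≢q meets))

injective-nsd-weighting : ∀ {n m} (G : Graph n m) → Nice G →
                          (W : Fin (2 * m) → ℕ) → Injective _≡_ _≡_ W →
                          ∃ λ (w : Fin m → ℕ) →
                            ValuesIn w W × EdgeInjective w × NeighbourSumDistinguishing G w
injective-nsd-weighting {m = m} G nice W W-inj
  with w , w-values , w-inj , w-dist ← greedy-weighting m (incidence G) (const 0) W W-inj
                                         (src G) (tgt G) (ℕ.≤-reflexive (cong (m +_) (sym (ℕ.+-identityʳ m))))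
  = w , w-values , w-inj , λ q σ≡σ → w-dist q (inj₂ (nice⇒ends-separated G nice q))
      (trans (sym (σ-weightedDegree G w (src G q))) (trans σ≡σ (σ-weightedDegree G w (tgt G q))))

valuesIn-suc∘toℕ⇒kWeighting : ∀ {m k} {w : Fin m → ℕ} → ValuesIn w (ℕ.suc ∘ toℕ {k}) → IsKWeighting k w
valuesIn-suc∘toℕ⇒kWeighting w-values i with w-values i
... | j , w≡ = subst (λ a → 1 ≤ a × a ≤ _) (sym w≡) (s≤s z≤n , Fin.toℕ<n j)

theorem4p1 : ∀ {n m} (G : Graph n m) → Nice G →
    ((W : Fin (2 * m) → ℕ) → Injective _≡_ _≡_ W → (∀ j → 0 < W j) →
      ∃ λ (w : Fin m → ℕ) →
        ValuesIn w W × EdgeInjective w × NeighbourSumDistinguishing G w)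
    × (∃ λ (w : Fin m → ℕ) →
        IsKWeighting (2 * m) w × EdgeInjective w × NeighbourSumDistinguishing G w)
theorem4p1 {m = m} G nice = (λ W W-inj _ → injective-nsd-weighting G nice W W-inj) , k-weighting
  where
  k-weighting : ∃ λ (w : Fin m → ℕ) →
                  IsKWeighting (2 * m) w × EdgeInjective w × NeighbourSumDistinguishing G w
  k-weighting = Product.map₂ (Product.map₁ valuesIn-suc∘toℕ⇒kWeighting)
    (injective-nsd-weighting G nice (ℕ.suc ∘ toℕ) (Fin.toℕ-injective ∘ ℕ.suc-injective))
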